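{- For every integer $n\geq 4$, the pendant path graph $P_n^*$ is not $n$-EKR.
   Context: $P_n$ is the path graph with vertices $x_1,\dots,x_n$ and edges $x_jx_{j+1}$ ($1\leq j\leq n-1$), and the pendant graph $P_n^*$ has vertex set $\{x_1,\dots,x_n\}\sqcup\{p_1,\dots,p_n\}$ and edge set $E(P_n)\sqcup\{x_1p_1,\dots,x_np_n\}$. For a graph $H$, $\mathcal{I}^{(r)}(H)$ is the family of independent sets of size $r$ and $\mathcal{I}^{(r)}_v(H)$ is the subfamily of those containing $v$ (the $r$-star centred at $v$). A family of sets is intersecting if every two members have nonempty intersection. $H$ is $r$-EKR if some $r$-star $\mathcal{I}^{(r)}_v(H)$ has maximum size among all intersecting subfamilies of $\mathcal{I}^{(r)}(H)$. -}

module Defs where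

open import Data.Nat using (ℕ; suc; _+_; _≤_)
open import Data.Fin using (Fin; toℕ; _↑ˡ_; _↑ʳ_)
open import Data.Fin.Subset using (Subset; _∈_; ∣_∣; _∩_; Nonempty)
open import Data.List using (List; length)
open import Data.List.Relation.Unary.Unique.Propositional using (Unique)
import Data.List.Membership.Propositional as LM
open import Data.Product using (Σ; _×_)
open import Data.Sum using (_⊎_)
open import Relation.Binary.PropositionalEquality using (_≡_)
open import Relation.Nullary using (¬_)

-- A (simple, undirected) graph on vertex set Fin m is given by an edge
-- relation E; adjacency is its symmetric closure.
Adjacent : {m : ℕ} → (Fin m → Fin m → Set) → Fin m → Fin m → Set
Adjacent E u v = E u v ⊎ E v u

Independent : {m : ℕ} → (Fin m → Fin m → Set) → Subset m → Set
Independent E A = ∀ u v → u ∈ A → v ∈ A → ¬ Adjacent E u v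

IndepOfSize : {m : ℕ} → (Fin m → Fin m → Set) → ℕ → Subset m → Set
IndepOfSize E r A = Independent E A × ∣ A ∣ ≡ r

-- A finite family of sets is represented by a duplicate-free list;
-- its size is the length of the list.
Intersecting : {m : ℕ} → List (Subset m) → Set
Intersecting F = ∀ {A B} → A LM.∈ F → B LM.∈ F → Nonempty (A ∩ B)

IntersectingFamily : {m : ℕ} → (Fin m → Fin m → Set) → ℕ → List (Subset m) → Set
IntersectingFamily E r F =
  Unique F × (∀ {A} → A LM.∈ F → IndepOfSize E r A) × Intersecting F

EnumeratesStar : {m : ℕ} → (Fin m → Fin m → Set) → ℕ → Fin m → List (Subset m) → Set
EnumeratesStar E r v S =
  Unique S × (∀ A → (A LM.∈ S → IndepOfSize E r A × v ∈ A)
                  × (IndepOfSize E r A → v ∈ A → A LM.∈ S))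

IsEKR : {m : ℕ} → (Fin m → Fin m → Set) → ℕ → Set
IsEKR {m} E r =
  Σ (Fin m) λ v → Σ (List (Subset m)) λ S →
    EnumeratesStar E r v S ×
    (∀ F → IntersectingFamily E r F → length F ≤ length S)

-- Pendant path graph P_n^* on Fin (n + n):
-- x_i is  i ↑ˡ n  (i.e. index i), p_i is  n ↑ʳ i  (i.e. index n + i).
data PendantPathEdge (n : ℕ) : Fin (n + n) → Fin (n + n) → Set where
  path : (i j : Fin n) → suc (toℕ i) ≡ toℕ j → PendantPathEdge n (i ↑ˡ n) (j ↑ˡ n)
  pend : (i : Fin n) → PendantPathEdge n (i ↑ˡ n) (n ↑ʳ i)

-- Every independent n-set of P_n^* contains exactly one vertex of each pendant
-- edge x_i p_i.  Consequently, if t ⊆ {1..n} has no two consecutive elements,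
-- then T_t := {x_i : i ∈ t} ∪ {p_i : i ∉ t} is an independent n-set, and if
-- moreover i, i+1 ∉ t then T_t meets every independent n-set A: A cannot
-- contain both x_i and x_{i+1}, so it contains p_i or p_{i+1}, both in T_t.
-- For every centre v there is such a t with v ∉ T_t (t = ∅ if v = x_i,
-- t = {i} if v = p_i; n ≥ 4 leaves room for the consecutive gap), so adding
-- T_t to the star at v gives a strictly larger intersecting family.
module Submission where

open import Defs
open import Data.Nat using (ℕ; suc; s≤s; _+_; _∸_; _≤_; _<_)
open import Data.Nat.Properties
  using (m+n∸m≡n; m+[n∸m]≡n; 1+n≢n; ≤-<-trans; <-irrefl; 1+n≰n)
open import Data.Bool using (true; false)
open import Data.Fin using (Fin; zero; suc; toℕ; _↑ˡ_; _↑ʳ_; splitAt)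
open import Data.Fin.Properties using (splitAt⁻¹-↑ˡ; splitAt⁻¹-↑ʳ)
open import Data.Fin.Subset
  using (Subset; _∈_; _∉_; _⊆_; ∣_∣; _∩_; Nonempty; ⊥; ∁; ⁅_⁆; _-_)
open import Data.Fin.Subset.Properties
  using (_∈?_; ∉⊥; ∣p∣≤n; ∣∁p∣≡n∸∣p∣; p⊆q⇒∣p∣≤∣q∣; x∈p⇒∣p-x∣<∣p∣;
         x∉p⇒x∈∁p; x∈∁p⇒x∉p; x∈p∧x≢y⇒x∈p-y; x∈p∩q⁺; ∩-comm;
         x∈⁅x⁆; x∈⁅y⁆⇒x≡y; x≢y⇒x∉⁅y⁆)
open import Data.Vec using ([]; _∷_; _++_)
import Data.Vec as Vec
open import Data.Vec.Properties using (lookup-++ˡ; lookup-++ʳ; lookup⇒[]=; []=⇒lookup)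
open import Data.List using (_∷_)
import Data.List.Membership.Propositional as List
open import Data.List.Relation.Unary.Any using (here; there)
import Data.List.Relation.Unary.All as All
open import Data.List.Relation.Unary.AllPairs using (_∷_)
open import Data.Product using (_×_; _,_; proj₁; proj₂; ∃; ∃₂)
open import Data.Sum using (_⊎_; inj₁; inj₂)
open import Relation.Binary.PropositionalEquality
  using (_≡_; _≢_; refl; sym; trans; cong; subst)
open import Relation.Nullary using (¬_; yes; no; contradiction)

private
  variable
    m n : ℕ

∣p++q∣≡∣p∣+∣q∣ : (p : Subset m) (q : Subset n) → ∣ p ++ q ∣ ≡ ∣ p ∣ + ∣ q ∣
∣p++q∣≡∣p∣+∣q∣ []          q = refl
∣p++q∣≡∣p∣+∣q∣ (true ∷ p)  q = cong suc (∣p++q∣≡∣p∣+∣q∣ p q)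
∣p++q∣≡∣p∣+∣q∣ (false ∷ p) q = ∣p++q∣≡∣p∣+∣q∣ p q

∣p∣+∣∁p∣≡n : (p : Subset n) → ∣ p ∣ + ∣ ∁ p ∣ ≡ n
∣p∣+∣∁p∣≡n p = trans (cong (∣ p ∣ +_) (∣∁p∣≡n∸∣p∣ p)) (m+[n∸m]≡n (∣p∣≤n p))

-- A point outside both sets would squeeze q into ∁ p minus that point, a set of
-- size n ∸ ∣ p ∣ ∸ 1.
disjoint-∣p∣+∣q∣≡n⇒x∈p⊎x∈q : (p q : Subset n) → (∀ {x} → x ∈ q → x ∉ p) →
                              ∣ p ∣ + ∣ q ∣ ≡ n → ∀ x → x ∈ p ⊎ x ∈ q
disjoint-∣p∣+∣q∣≡n⇒x∈p⊎x∈q {n} p q disjoint size x with x ∈? p | x ∈? q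
... | yes x∈p | _       = inj₁ x∈p
... | no _    | yes x∈q = inj₂ x∈q
... | no x∉p  | no x∉q  =
  contradiction (≤-<-trans (p⊆q⇒∣p∣≤∣q∣ q⊆∁p-x) ∣∁p-x∣<n∸∣p∣) (<-irrefl ∣q∣≡n∸∣p∣)
  where
  q⊆∁p-x : q ⊆ ∁ p - x
  q⊆∁p-x y∈q = x∈p∧x≢y⇒x∈p-y (x∉p⇒x∈∁p (disjoint y∈q)) λ { refl → x∉q y∈q }
  ∣∁p-x∣<n∸∣p∣ : ∣ ∁ p - x ∣ < n ∸ ∣ p ∣
  ∣∁p-x∣<n∸∣p∣ = subst (∣ ∁ p - x ∣ <_) (∣∁p∣≡n∸∣p∣ p) (x∈p⇒∣p-x∣<∣p∣ (x∉p⇒x∈∁p x∉p))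
  ∣q∣≡n∸∣p∣ : ∣ q ∣ ≡ n ∸ ∣ p ∣
  ∣q∣≡n∸∣p∣ = trans (sym (m+n∸m≡n ∣ p ∣ ∣ q ∣)) (cong (_∸ ∣ p ∣) size)

module _ (p : Subset m) (q : Subset n) where

  ∈-++⁺ˡ : ∀ {x} → x ∈ p → x ↑ˡ n ∈ p ++ q
  ∈-++⁺ˡ {x} x∈p = lookup⇒[]= (x ↑ˡ n) (p ++ q) (trans (lookup-++ˡ p q x) ([]=⇒lookup x∈p))

  ∈-++⁻ˡ : ∀ {x} → x ↑ˡ n ∈ p ++ q → x ∈ p
  ∈-++⁻ˡ {x} x∈p++q = lookup⇒[]= x p (trans (sym (lookup-++ˡ p q x)) ([]=⇒lookup x∈p++q))

  ∈-++⁺ʳ : ∀ {x} → x ∈ q → m ↑ʳ x ∈ p ++ q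
  ∈-++⁺ʳ {x} x∈q = lookup⇒[]= (m ↑ʳ x) (p ++ q) (trans (lookup-++ʳ p q x) ([]=⇒lookup x∈q))

  ∈-++⁻ʳ : ∀ {x} → m ↑ʳ x ∈ p ++ q → x ∈ q
  ∈-++⁻ʳ {x} x∈p++q = lookup⇒[]= x q (trans (sym (lookup-++ʳ p q x)) ([]=⇒lookup x∈p++q))

↑-elim : (P : Fin (m + n) → Set) → (∀ i → P (i ↑ˡ n)) → (∀ j → P (m ↑ʳ j)) → ∀ x → P x
↑-elim {m} P left right x with splitAt m x in eq
... | inj₁ i = subst P (splitAt⁻¹-↑ˡ eq) (left i)
... | inj₂ j = subst P (splitAt⁻¹-↑ʳ eq) (right j)

module _ {E : Fin m → Fin m → Set} {r : ℕ} where

  Hits : Subset m → Set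
  Hits B = ∀ A → IndepOfSize E r A → Nonempty (A ∩ B)

  star-extends : ∀ {w S B} → EnumeratesStar E r w S → IndepOfSize E r B → w ∉ B → Hits B →
                 IntersectingFamily E r (B ∷ S)
  star-extends {w} {S} {B} (unique , enumerates) B-indep w∉B hits =
    (All.tabulate B≢ ∷ unique) , indep , intersecting
    where
    inStar : ∀ {A} → A List.∈ S → IndepOfSize E r A × w ∈ A
    inStar {A} = proj₁ (enumerates A)
    B≢ : ∀ {A} → A List.∈ S → B ≢ A
    B≢ A∈S refl = w∉B (proj₂ (inStar A∈S))
    indep : ∀ {A} → A List.∈ B ∷ S → IndepOfSize E r A
    indep (here refl) = B-indep
    indep (there A∈S) = proj₁ (inStar A∈S)
    intersecting : Intersecting (B ∷ S)
    intersecting (here refl)  (here refl)   = hits B B-indep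
    intersecting (here refl)  (there A∈S)   =
      subst Nonempty (∩-comm _ B) (hits _ (proj₁ (inStar A∈S)))
    intersecting (there A∈S)  (here refl)   = hits _ (proj₁ (inStar A∈S))
    intersecting (there A∈S)  (there A′∈S)  =
      w , x∈p∩q⁺ (proj₂ (inStar A∈S) , proj₂ (inStar A′∈S))

module _ {n : ℕ} where

  NoConsecutive : Subset n → Set
  NoConsecutive t = ∀ i j → suc (toℕ i) ≡ toℕ j → i ∈ t → j ∉ t

  ConsecutiveGap : Subset n → Set
  ConsecutiveGap t = ∃₂ λ i j → suc (toℕ i) ≡ toℕ j × i ∉ t × j ∉ t

  -- x_i ↦ i ↑ˡ n and p_i ↦ n ↑ʳ i, so this is {x_i : i ∈ t} ∪ {p_i : i ∉ t}.
  transversal : Subset n → Subset (n + n)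
  transversal t = t ++ ∁ t

  AvoidingTransversal : Fin (n + n) → Subset n → Set
  AvoidingTransversal v t = NoConsecutive t × ConsecutiveGap t × v ∉ transversal t

  pendant-covered : ∀ A → IndepOfSize (PendantPathEdge n) n A → ∀ i → i ↑ˡ n ∈ A ⊎ n ↑ʳ i ∈ A
  pendant-covered A (indep , size) i with Vec.splitAt n A
  ... | xs , ps , refl with disjoint-∣p∣+∣q∣≡n⇒x∈p⊎x∈q xs ps disjoint
                              (trans (sym (∣p++q∣≡∣p∣+∣q∣ xs ps)) size) i
    where
    disjoint : ∀ {j} → j ∈ ps → j ∉ xs
    disjoint {j} j∈ps j∈xs = indep _ _ (∈-++⁺ˡ xs ps j∈xs) (∈-++⁺ʳ xs ps j∈ps) (inj₁ (pend j))
  ... | inj₁ i∈xs = inj₁ (∈-++⁺ˡ xs ps i∈xs)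
  ... | inj₂ i∈ps = inj₂ (∈-++⁺ʳ xs ps i∈ps)

  transversal-independent : ∀ {t} → NoConsecutive t → IndepOfSize (PendantPathEdge n) n (transversal t)
  transversal-independent {t} noConsecutive = indep , size
    where
    edgeFree : ∀ u v → u ∈ transversal t → v ∈ transversal t → ¬ PendantPathEdge n u v
    edgeFree _ _ u∈ v∈ (path i j e) = noConsecutive i j e (∈-++⁻ˡ t (∁ t) u∈) (∈-++⁻ˡ t (∁ t) v∈)
    edgeFree _ _ u∈ v∈ (pend i)     = x∈∁p⇒x∉p (∈-++⁻ʳ t (∁ t) v∈) (∈-++⁻ˡ t (∁ t) u∈)
    indep : Independent (PendantPathEdge n) (transversal t)
    indep u v u∈ v∈ (inj₁ uv) = edgeFree u v u∈ v∈ uv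
    indep u v u∈ v∈ (inj₂ vu) = edgeFree v u v∈ u∈ vu
    size : ∣ transversal t ∣ ≡ n
    size = trans (∣p++q∣≡∣p∣+∣q∣ t (∁ t)) (∣p∣+∣∁p∣≡n t)

  transversal-hits : ∀ {t} → ConsecutiveGap t → Hits {E = PendantPathEdge n} {r = n} (transversal t)
  transversal-hits {t} (i , j , e , i∉t , j∉t) A A-indep
    with pendant-covered A A-indep i | pendant-covered A A-indep j
  ... | inj₂ pᵢ∈A | _         = _ , x∈p∩q⁺ (pᵢ∈A , ∈-++⁺ʳ t (∁ t) (x∉p⇒x∈∁p i∉t))
  ... | inj₁ _    | inj₂ pⱼ∈A = _ , x∈p∩q⁺ (pⱼ∈A , ∈-++⁺ʳ t (∁ t) (x∉p⇒x∈∁p j∉t))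
  ... | inj₁ xᵢ∈A | inj₁ xⱼ∈A = contradiction (inj₁ (path i j e)) (proj₁ A-indep _ _ xᵢ∈A xⱼ∈A)

NoConsecutive-⊥ : NoConsecutive (⊥ {n})
NoConsecutive-⊥ _ _ _ i∈⊥ _ = ∉⊥ i∈⊥

NoConsecutive-⁅⁆ : (i : Fin n) → NoConsecutive ⁅ i ⁆
NoConsecutive-⁅⁆ i j k e j∈⁅i⁆ k∈⁅i⁆ with x∈⁅y⁆⇒x≡y i j∈⁅i⁆ | x∈⁅y⁆⇒x≡y i k∈⁅i⁆
... | refl | refl = 1+n≢n e

ConsecutiveGap-⊥ : ConsecutiveGap (⊥ {2 + n})
ConsecutiveGap-⊥ = zero , suc zero , refl , ∉⊥ , ∉⊥

consecutive-avoiding : (k : Fin (4 + n)) → ∃₂ λ i j → suc (toℕ i) ≡ toℕ j × i ≢ k × j ≢ k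
consecutive-avoiding zero          = suc (suc zero) , suc (suc (suc zero)) , refl , (λ ()) , (λ ())
consecutive-avoiding (suc zero)    = suc (suc zero) , suc (suc (suc zero)) , refl , (λ ()) , (λ ())
consecutive-avoiding (suc (suc _)) = zero , suc zero , refl , (λ ()) , (λ ())

ConsecutiveGap-⁅⁆ : (k : Fin (4 + n)) → ConsecutiveGap ⁅ k ⁆
ConsecutiveGap-⁅⁆ k with i , j , e , i≢k , j≢k ← consecutive-avoiding k =
  i , j , e , x≢y⇒x∉⁅y⁆ i≢k , x≢y⇒x∉⁅y⁆ j≢k

avoiding-transversal : (v : Fin ((4 + n) + (4 + n))) → ∃ (AvoidingTransversal {4 + n} v)
avoiding-transversal {n} = ↑-elim _ avoid-x avoid-p
  where
  avoid-x : (i : Fin (4 + n)) → ∃ (AvoidingTransversal {4 + n} (i ↑ˡ (4 + n)))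
  avoid-x i = ⊥ , NoConsecutive-⊥ , ConsecutiveGap-⊥ , λ xᵢ∈T → ∉⊥ (∈-++⁻ˡ ⊥ (∁ ⊥) xᵢ∈T)
  avoid-p : (i : Fin (4 + n)) → ∃ (AvoidingTransversal {4 + n} ((4 + n) ↑ʳ i))
  avoid-p i = ⁅ i ⁆ , NoConsecutive-⁅⁆ i , ConsecutiveGap-⁅⁆ i ,
              λ pᵢ∈T → x∈∁p⇒x∉p (∈-++⁻ʳ ⁅ i ⁆ (∁ ⁅ i ⁆) pᵢ∈T) (x∈⁅x⁆ i)

lemma9 : (n : ℕ) → 4 ≤ n → ¬ IsEKR (PendantPathEdge n) n
lemma9 (suc (suc (suc (suc n)))) (s≤s (s≤s (s≤s (s≤s _)))) (v , S , star , maximum)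
  with t , noConsecutive , gap , v∉T ← avoiding-transversal {n} v =
  1+n≰n (maximum _ (star-extends star (transversal-independent noConsecutive) v∉T
                                      (transversal-hits gap)))
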